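{- Let $L$ be a $24$-dimensional odd unimodular lattice, let $L_0$ be its even sublattice (the vectors of even norm), write $L=L_0\cup L_2$ and $L_0^*=L_0\cup L_2\cup L_1\cup L_3$ as a union of cosets of $L_0$, so that the shadow of $L$ is $S=L_1\cup L_3$. Let $v\in L_2$ with $(v,v)=3$. If there exist $a\in L_1$ and $b\in L_3$ such that $(a,a)=(b,b)=2$, $(a,b)=1/2$ and $v=a-b$, then $v$ does not belong to any $3$-frame of $L$.
   Context: A lattice $L\subset\mathbb{R}^n$ is integral if $L\subseteq L^*$, where $L^*=\{x\in\mathbb{R}^n : (x,y)\in\mathbb{Z}\text{ for all }y\in L\}$, and unimodular if $L=L^*$. A unimodular lattice is odd if it contains a vector of odd norm $(x,x)$. For an odd unimodular lattice, $L_0^*/L_0$ has order $4$, with cosets $L_0, L_2=L\setminus L_0, L_1, L_3$. A $3$-frame of an $n$-dimensional lattice $L$ is a set $\{f_1,\dots,f_n\}\subset L$ with $(f_i,f_j)=3\delta_{ij}$. -}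

module Defs where

open import Data.Nat using (ℕ; zero; suc)
open import Data.Fin using (Fin; zero; suc)
open import Data.Integer using (ℤ; +_)
open import Data.Rational using (ℚ; _+_; _*_; _-_; _/_; 0ℚ; _<_)
open import Data.Product using (Σ; ∃; _×_)
open import Relation.Nullary using (¬_)
open import Relation.Binary.PropositionalEquality using (_≡_; _≢_)

Σ[_]_ : (n : ℕ) → (Fin n → ℚ) → ℚ
Σ[ zero ] f = 0ℚ
Σ[ suc n ] f = f zero + Σ[ n ] (λ i → f (suc i))

-- A lattice of rank n is described (up to isometry) by its Gram matrix G
-- with respect to a basis; vectors of the ambient rational space L ⊗ ℚ
-- are coordinate vectors Fin n → ℚ with respect to this basis.
Vec : ℕ → Set
Vec n = Fin n → ℚ

Gram : ℕ → Set
Gram n = Fin n → Fin n → ℚ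

_-ᵥ_ : ∀ {n} → Vec n → Vec n → Vec n
(x -ᵥ y) i = x i - y i

zeroᵥ : ∀ {n} → Vec n
zeroᵥ i = 0ℚ

inner : ∀ {n} → Gram n → Vec n → Vec n → ℚ
inner {n} G x y = Σ[ n ] (λ i → Σ[ n ] (λ j → x i * G i j * y j))

norm : ∀ {n} → Gram n → Vec n → ℚ
norm G x = inner G x x

IsInt : ℚ → Set
IsInt q = Σ ℤ (λ z → q ≡ z / 1)

IsEvenInt : ℚ → Set
IsEvenInt q = Σ ℤ (λ z → q ≡ (z Data.Integer.* + 2) / 1)

IsOddInt : ℚ → Set
IsOddInt q = Σ ℤ (λ z → q ≡ ((z Data.Integer.* + 2) Data.Integer.+ + 1) / 1)

InL : ∀ {n} → Vec n → Set
InL x = ∀ i → IsInt (x i)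

IsLatticeGram : ∀ {n} → Gram n → Set
IsLatticeGram G = (∀ i j → G i j ≡ G j i)
                × (∀ x → InL x → ¬ (∀ i → x i ≡ 0ℚ) → 0ℚ < norm G x)

InDual : ∀ {n} → Gram n → Vec n → Set
InDual G x = ∀ y → InL y → IsInt (inner G x y)

IsIntegral : ∀ {n} → Gram n → Set
IsIntegral G = ∀ x → InL x → InDual G x

IsUnimodular : ∀ {n} → Gram n → Set
IsUnimodular G = IsIntegral G × (∀ x → InDual G x → InL x)

IsOdd : ∀ {n} → Gram n → Set
IsOdd G = Σ (Vec _) (λ x → InL x × IsOddInt (norm G x))

InL0 : ∀ {n} → Gram n → Vec n → Set
InL0 G x = InL x × IsEvenInt (norm G x)

InL2 : ∀ {n} → Gram n → Vec n → Set
InL2 G x = InL x × ¬ InL0 G x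

InL0Dual : ∀ {n} → Gram n → Vec n → Set
InL0Dual G x = ∀ y → InL0 G y → IsInt (inner G x y)

InShadow : ∀ {n} → Gram n → Vec n → Set
InShadow G x = InL0Dual G x × ¬ InL x

SameCoset : ∀ {n} → Gram n → Vec n → Vec n → Set
SameCoset G x y = InL0 G (x -ᵥ y)

Is3Frame : ∀ {n} → Gram n → (Fin n → Vec n) → Set
Is3Frame G f = (∀ i → InL (f i))
             × (∀ i → inner G (f i) (f i) ≡ + 3 / 1)
             × (∀ i j → i ≢ j → inner G (f i) (f j) ≡ 0ℚ)

InSome3Frame : ∀ {n} → Gram n → Vec n → Set
InSome3Frame {n} G v =
  Σ (Fin n → Vec n) (λ f → Is3Frame G f × Σ (Fin n) (λ i → ∀ k → f i k ≡ v k))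

module Submission where

-- Let a ∈ L₁ with (a, a) = 2 and (a, b) = ½, and suppose v = a − b, of norm 3,
-- is the vector fᵢ of a 3-frame f of the unimodular lattice L of rank 24.
-- Then 2 (a, fᵢ) = 2 ((a, a) − (a, b)) = 3 is odd, and since a ∈ L₀* this
-- makes x = 2a a characteristic vector of L: (x, y) ≡ (y, y) (mod 2) for
-- all y ∈ L.  A characteristic vector lies in L* = L, so every cⱼ = (x, fⱼ)
-- is an odd integer, and cᵢ = 3.  Hence Σⱼ cⱼ² ≥ 23 + 9 > 24.  On the other
-- hand Bessel's inequality for the orthogonal frame gives
-- Σⱼ cⱼ² ≤ 3 (x, x) = 3 · 8 = 24, a contradiction.

open import Defs
open import Data.Integer using (+_)
open import Data.Rational using (_/_; ½)
open import Data.Product using (Σ; _×_)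
open import Relation.Nullary using (¬_)
open import Relation.Binary.PropositionalEquality using (_≡_)

open import Data.Nat as ℕ using (ℕ; zero; suc; s≤s; z≤n)
import Data.Nat.Properties as ℕ
import Data.Nat.Coprimality as Coprime
open import Data.Integer as ℤ using (ℤ; -[1+_])
import Data.Integer.Properties as ℤ
import Data.Integer.DivMod as ℤ
import Data.Integer.Solver
open import Data.Rational using (ℚ; mkℚ; _+_; _*_; -_; _-_; 0ℚ; _≤_; _<_; *≤*; *<*; Positive)
open import Data.Rational.Properties
  using (normalize-coprime; +-identityˡ; +-identityʳ; *-zeroʳ; *-distribˡ-+;
         +-mono-≤; +-mono-<-≤; +-mono-≤-<; <-irrefl; <⇒≤; ≤-reflexive; <-≤-trans;
         +-monoʳ-≤; *-cancelˡ-≤-pos; _≟_; module ≤-Reasoning)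
open import Data.Rational.Solver using (module +-*-Solver)
open import Data.Fin using (Fin; zero; suc)
open import Data.Fin.Properties using (suc-injective; all?)
open import Data.Sum using (_⊎_; inj₁; inj₂; [_,_])
open import Data.Product using (_,_; proj₁; proj₂)
open import Relation.Nullary using (yes; no)
open import Relation.Binary.PropositionalEquality
  using (refl; sym; trans; cong; cong₂; subst; subst₂; _≢_; module ≡-Reasoning)

ι : ℤ → ℚ
ι z = z / 1

coprime-to-1 : ∀ z → Coprime.Coprime ℤ.∣ z ∣ 1
coprime-to-1 z = Coprime.sym (Coprime.1-coprimeTo ℤ.∣ z ∣)

-- ι z is the reduced fraction z/1; this makes ι compute through _+_ and _*_.
ι-canonical : ∀ z → ι z ≡ mkℚ z 0 (coprime-to-1 z)
ι-canonical (+ n)    = normalize-coprime (coprime-to-1 (+ n))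
ι-canonical -[1+ n ] = cong -_ (normalize-coprime (coprime-to-1 (+ suc n)))

ι-+ : ∀ z w → ι z + ι w ≡ ι (z ℤ.+ w)
ι-+ z w rewrite ι-canonical z | ι-canonical w =
  cong₂ (λ p q → (p ℤ.+ q) / 1) (ℤ.*-identityʳ z) (ℤ.*-identityʳ w)

ι-* : ∀ z w → ι z * ι w ≡ ι (z ℤ.* w)
ι-* z w rewrite ι-canonical z | ι-canonical w = refl

ι-neg : ∀ z → - ι z ≡ ι (ℤ.- z)
ι-neg (+ zero)  = refl
ι-neg (+ suc n) = refl
ι-neg -[1+ n ]  = solve 1 (λ p → :- :- p := p) refl (ι (+ suc n))
  where open +-*-Solver

ι-- : ∀ z w → ι z - ι w ≡ ι (z ℤ.- w)
ι-- z w = trans (cong (λ q → ι z + q) (ι-neg w)) (ι-+ z (ℤ.- w))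

ι-mono-≤ : ∀ {z w} → z ℤ.≤ w → ι z ≤ ι w
ι-mono-≤ {z} {w} z≤w rewrite ι-canonical z | ι-canonical w =
  *≤* (subst₂ ℤ._≤_ (sym (ℤ.*-identityʳ z)) (sym (ℤ.*-identityʳ w)) z≤w)

int-+ : ∀ {p q} → IsInt p → IsInt q → IsInt (p + q)
int-+ (z , refl) (w , refl) = z ℤ.+ w , ι-+ z w

int-* : ∀ {p q} → IsInt p → IsInt q → IsInt (p * q)
int-* (z , refl) (w , refl) = z ℤ.* w , ι-* z w

int-- : ∀ {p q} → IsInt p → IsInt q → IsInt (p - q)
int-- (z , refl) (w , refl) = z ℤ.- w , ι-- z w

even⇒int : ∀ {p} → IsEvenInt p → IsInt p
even⇒int (z , e) = z ℤ.* + 2 , e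

odd⇒int : ∀ {p} → IsOddInt p → IsInt p
odd⇒int (z , e) = z ℤ.* + 2 ℤ.+ + 1 , e

parity : ∀ {p} → IsInt p → IsEvenInt p ⊎ IsOddInt p
parity (z , refl) with z ℤ.% + 2 | ℤ.a≡a%n+[a/n]*n z (+ 2) | ℤ.n%d<d z (+ 2)
... | 0           | z≡ | _ = inj₁ (z ℤ./ + 2 , cong ι (trans z≡ (ℤ.+-identityˡ (z ℤ./ + 2 ℤ.* + 2))))
... | 1           | z≡ | _ = inj₂ (z ℤ./ + 2 , cong ι (trans z≡ (ℤ.+-comm (+ 1) (z ℤ./ + 2 ℤ.* + 2))))
... | suc (suc r) | _  | s≤s (s≤s ())

module _ where
  open Data.Integer.Solver.+-*-Solver

  odd+odd : ∀ {p q} → IsOddInt p → IsOddInt q → IsEvenInt (p + q)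
  odd+odd (z , refl) (w , refl) = z ℤ.+ w ℤ.+ + 1 , trans (ι-+ (z ℤ.* + 2 ℤ.+ + 1) (w ℤ.* + 2 ℤ.+ + 1)) (cong ι
    (solve 2 (λ z w → (z :* con (+ 2) :+ con (+ 1)) :+ (w :* con (+ 2) :+ con (+ 1))
                      := (z :+ w :+ con (+ 1)) :* con (+ 2)) refl z w))

  even+odd : ∀ {p q} → IsEvenInt p → IsOddInt q → IsOddInt (p + q)
  even+odd (z , refl) (w , refl) = z ℤ.+ w , trans (ι-+ (z ℤ.* + 2) (w ℤ.* + 2 ℤ.+ + 1)) (cong ι
    (solve 2 (λ z w → z :* con (+ 2) :+ (w :* con (+ 2) :+ con (+ 1))
                      := (z :+ w) :* con (+ 2) :+ con (+ 1)) refl z w))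

  even-even : ∀ {p q} → IsEvenInt p → IsEvenInt q → IsEvenInt (p - q)
  even-even (z , refl) (w , refl) = z ℤ.- w , trans (ι-- (z ℤ.* + 2) (w ℤ.* + 2)) (cong ι
    (solve 2 (λ z w → z :* con (+ 2) :- w :* con (+ 2) := (z :- w) :* con (+ 2)) refl z w))

  twice-even : ∀ {p} → IsInt p → IsEvenInt (ι (+ 2) * p)
  twice-even (z , refl) = z , trans (ι-* (+ 2) z) (cong ι (ℤ.*-comm (+ 2) z))

odd-square≥1 : ∀ {p} → IsOddInt p → ι (+ 1) ≤ p * p
odd-square≥1 (z , refl) = subst (ι (+ 1) ≤_) (sym (ι-* w w)) (ι-mono-≤ (square≥1 z))
  where
  w : ℤ
  w = z ℤ.* + 2 ℤ.+ + 1
  square≥1 : ∀ t → + 1 ℤ.≤ (t ℤ.* + 2 ℤ.+ + 1) ℤ.* (t ℤ.* + 2 ℤ.+ + 1)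
  square≥1 -[1+ n ] = ℤ.+≤+ (s≤s z≤n)
  square≥1 (+ n) rewrite sym (ℤ.pos-* n 2) | sym (ℤ.pos-+ (n ℕ.* 2) 1) | ℕ.+-comm (n ℕ.* 2) 1
    = ℤ.+≤+ (s≤s z≤n)

Σ-cong : ∀ n {f g : Fin n → ℚ} → (∀ i → f i ≡ g i) → Σ[ n ] f ≡ Σ[ n ] g
Σ-cong zero    f≡g = refl
Σ-cong (suc n) f≡g = cong₂ _+_ (f≡g zero) (Σ-cong n (λ i → f≡g (suc i)))

Σ-zero : ∀ n → Σ[ n ] (λ _ → 0ℚ) ≡ 0ℚ
Σ-zero zero    = refl
Σ-zero (suc n) = trans (cong (λ s → 0ℚ + s) (Σ-zero n)) (+-identityˡ 0ℚ)

Σ-+ : ∀ n (f g : Fin n → ℚ) → Σ[ n ] (λ i → f i + g i) ≡ Σ[ n ] f + Σ[ n ] g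
Σ-+ zero    f g = sym (+-identityˡ 0ℚ)
Σ-+ (suc n) f g = trans (cong (λ s → f zero + g zero + s) (Σ-+ n (λ i → f (suc i)) (λ i → g (suc i))))
  (solve 4 (λ a b c d → (a :+ b) :+ (c :+ d) := (a :+ c) :+ (b :+ d)) refl
     (f zero) (g zero) (Σ[ n ] (λ i → f (suc i))) (Σ[ n ] (λ i → g (suc i))))
  where open +-*-Solver

Σ-* : ∀ n c (f : Fin n → ℚ) → Σ[ n ] (λ i → c * f i) ≡ c * Σ[ n ] f
Σ-* zero    c f = sym (*-zeroʳ c)
Σ-* (suc n) c f = trans (cong (λ s → c * f zero + s) (Σ-* n c (λ i → f (suc i)))) (sym (*-distribˡ-+ c _ _))

Σ-- : ∀ n (f g : Fin n → ℚ) → Σ[ n ] (λ i → f i - g i) ≡ Σ[ n ] f - Σ[ n ] g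
Σ-- zero    f g = refl
Σ-- (suc n) f g = trans (cong (λ s → f zero - g zero + s) (Σ-- n (λ i → f (suc i)) (λ i → g (suc i))))
  (solve 4 (λ a b c d → (a :- b) :+ (c :- d) := (a :+ c) :- (b :+ d)) refl
     (f zero) (g zero) (Σ[ n ] (λ i → f (suc i))) (Σ[ n ] (λ i → g (suc i))))
  where open +-*-Solver

Σ-swap : ∀ n m (f : Fin n → Fin m → ℚ) →
  Σ[ n ] (λ i → Σ[ m ] (λ j → f i j)) ≡ Σ[ m ] (λ j → Σ[ n ] (λ i → f i j))
Σ-swap zero    m f = sym (Σ-zero m)
Σ-swap (suc n) m f = trans (cong (λ s → Σ[ m ] (f zero) + s) (Σ-swap n m (λ i → f (suc i))))
  (sym (Σ-+ m (f zero) (λ j → Σ[ n ] (λ i → f (suc i) j))))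

Σ-δ : ∀ n (i : Fin n) (f : Fin n → ℚ) → (∀ j → j ≢ i → f j ≡ 0ℚ) → Σ[ n ] f ≡ f i
Σ-δ (suc n) zero f off-i =
  trans (cong (λ s → f zero + s) (trans (Σ-cong n (λ j → off-i (suc j) (λ ()))) (Σ-zero n))) (+-identityʳ _)
Σ-δ (suc n) (suc i) f off-i =
  trans (cong (_+ Σ[ n ] (λ j → f (suc j))) (off-i zero (λ ())))
    (trans (+-identityˡ _) (Σ-δ n i (λ j → f (suc j)) (λ j j≢i → off-i (suc j) (λ e → j≢i (suc-injective e)))))

Σ-int : ∀ n (f : Fin n → ℚ) → (∀ i → IsInt (f i)) → IsInt (Σ[ n ] f)
Σ-int zero    f f-int = + 0 , refl
Σ-int (suc n) f f-int = int-+ (f-int zero) (Σ-int n (λ i → f (suc i)) (λ i → f-int (suc i)))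

Σ-mono-≤ : ∀ n (f g : Fin n → ℚ) → (∀ i → f i ≤ g i) → Σ[ n ] f ≤ Σ[ n ] g
Σ-mono-≤ zero    f g f≤g = ≤-reflexive refl
Σ-mono-≤ (suc n) f g f≤g = +-mono-≤ (f≤g zero) (Σ-mono-≤ n _ _ (λ i → f≤g (suc i)))

Σ-mono-< : ∀ n (f g : Fin n → ℚ) (i : Fin n) → (∀ j → f j ≤ g j) → f i < g i → Σ[ n ] f < Σ[ n ] g
Σ-mono-< (suc n) f g zero    f≤g fi<gi = +-mono-<-≤ fi<gi (Σ-mono-≤ n _ _ (λ j → f≤g (suc j)))
Σ-mono-< (suc n) f g (suc i) f≤g fi<gi = +-mono-≤-< (f≤g zero) (Σ-mono-< n _ _ i (λ j → f≤g (suc j)) fi<gi)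

Σ-exceeds-count : ∀ n (f : Fin n → ℚ) (i : Fin n) → (∀ j → ι (+ 1) ≤ f j) → ι (+ 1) < f i → ι (+ n) < Σ[ n ] f
Σ-exceeds-count n f i f≥1 fi>1 =
  subst (_< Σ[ n ] f) (Σ-ones n) (Σ-mono-< n (λ _ → ι (+ 1)) f i f≥1 fi>1)
  where
  Σ-ones : ∀ n → Σ[ n ] (λ _ → ι (+ 1)) ≡ ι (+ n)
  Σ-ones zero    = refl
  Σ-ones (suc n) = trans (cong (λ s → ι (+ 1) + s) (Σ-ones n)) (ι-+ (+ 1) (+ n))

_·_ : ∀ {n} → ℚ → Vec n → Vec n
(c · x) k = c * x k

combo : ∀ {m n} → (Fin m → ℚ) → (Fin m → Vec n) → Vec n
combo {m} c f k = Σ[ m ] (λ j → c j * f j k)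

module Form {n : ℕ} (G : Gram n) (G-sym : ∀ i j → G i j ≡ G j i) where
  open +-*-Solver

  ⟪_,_⟫ : Vec n → Vec n → ℚ
  ⟪ x , y ⟫ = inner G x y

  termwise-+ : ∀ {x y x₁ y₁ x₂ y₂ : Vec n} →
    (∀ i j → x i * G i j * y j ≡ x₁ i * G i j * y₁ j + x₂ i * G i j * y₂ j) →
    ⟪ x , y ⟫ ≡ ⟪ x₁ , y₁ ⟫ + ⟪ x₂ , y₂ ⟫
  termwise-+ e = trans (Σ-cong n (λ i → trans (Σ-cong n (e i)) (Σ-+ n _ _))) (Σ-+ n _ _)

  termwise-- : ∀ {x y x₁ y₁ x₂ y₂ : Vec n} →
    (∀ i j → x i * G i j * y j ≡ x₁ i * G i j * y₁ j - x₂ i * G i j * y₂ j) →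
    ⟪ x , y ⟫ ≡ ⟪ x₁ , y₁ ⟫ - ⟪ x₂ , y₂ ⟫
  termwise-- e = trans (Σ-cong n (λ i → trans (Σ-cong n (e i)) (Σ-- n _ _))) (Σ-- n _ _)

  termwise-* : ∀ c {x y x₁ y₁ : Vec n} →
    (∀ i j → x i * G i j * y j ≡ c * (x₁ i * G i j * y₁ j)) → ⟪ x , y ⟫ ≡ c * ⟪ x₁ , y₁ ⟫
  termwise-* c e = trans (Σ-cong n (λ i → trans (Σ-cong n (e i)) (Σ-* n c _))) (Σ-* n c _)

  inner-congʳ : ∀ x {y y′ : Vec n} → (∀ k → y k ≡ y′ k) → ⟪ x , y ⟫ ≡ ⟪ x , y′ ⟫
  inner-congʳ x y≡y′ = Σ-cong n (λ i → Σ-cong n (λ j → cong (x i * G i j *_) (y≡y′ j)))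

  inner-zeroʳ : ∀ x → ⟪ x , (λ _ → 0ℚ) ⟫ ≡ 0ℚ
  inner-zeroʳ x = trans (Σ-cong n (λ i → trans (Σ-cong n (λ j → *-zeroʳ (x i * G i j))) (Σ-zero n))) (Σ-zero n)

  inner-sym : ∀ x y → ⟪ x , y ⟫ ≡ ⟪ y , x ⟫
  inner-sym x y = trans (Σ-swap n n (λ i j → x i * G i j * y j)) (Σ-cong n (λ i → Σ-cong n (λ j →
    trans (cong (λ g → x j * g * y i) (G-sym j i))
      (solve 3 (λ a g b → a :* g :* b := b :* g :* a) refl (x j) (G i j) (y i)))))

  inner-+ʳ : ∀ x y z → ⟪ x , (λ k → y k + z k) ⟫ ≡ ⟪ x , y ⟫ + ⟪ x , z ⟫
  inner-+ʳ x y z = termwise-+ {x} {λ k → y k + z k} {x} {y} {x} {z} (λ i j →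
    solve 4 (λ a g b c → a :* g :* (b :+ c) := a :* g :* b :+ a :* g :* c) refl (x i) (G i j) (y j) (z j))

  inner--ʳ : ∀ x y z → ⟪ x , y -ᵥ z ⟫ ≡ ⟪ x , y ⟫ - ⟪ x , z ⟫
  inner--ʳ x y z = termwise-- {x} {y -ᵥ z} {x} {y} {x} {z} (λ i j →
    solve 4 (λ a g b c → a :* g :* (b :- c) := a :* g :* b :- a :* g :* c) refl (x i) (G i j) (y j) (z j))

  inner-·ʳ : ∀ c x y → ⟪ x , c · y ⟫ ≡ c * ⟪ x , y ⟫
  inner-·ʳ c x y = termwise-* c {x} {c · y} {x} {y} (λ i j →
    solve 4 (λ c a g b → a :* g :* (c :* b) := c :* (a :* g :* b)) refl c (x i) (G i j) (y j))

  inner--ˡ : ∀ x y z → ⟪ x -ᵥ y , z ⟫ ≡ ⟪ x , z ⟫ - ⟪ y , z ⟫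
  inner--ˡ x y z = begin
    ⟪ x -ᵥ y , z ⟫         ≡⟨ inner-sym (x -ᵥ y) z ⟩
    ⟪ z , x -ᵥ y ⟫         ≡⟨ inner--ʳ z x y ⟩
    ⟪ z , x ⟫ - ⟪ z , y ⟫  ≡⟨ cong₂ _-_ (inner-sym z x) (inner-sym z y) ⟩
    ⟪ x , z ⟫ - ⟪ y , z ⟫  ∎
    where open ≡-Reasoning

  inner-·ˡ : ∀ c x y → ⟪ c · x , y ⟫ ≡ c * ⟪ x , y ⟫
  inner-·ˡ c x y = trans (inner-sym (c · x) y) (trans (inner-·ʳ c y x) (cong (c *_) (inner-sym y x)))

  norm-- : ∀ x y → ⟪ x -ᵥ y , x -ᵥ y ⟫ ≡ (⟪ x , x ⟫ + ⟪ y , y ⟫) - ι (+ 2) * ⟪ x , y ⟫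
  norm-- x y = begin
    ⟪ x -ᵥ y , x -ᵥ y ⟫                                  ≡⟨ inner--ˡ x y (x -ᵥ y) ⟩
    ⟪ x , x -ᵥ y ⟫ - ⟪ y , x -ᵥ y ⟫                      ≡⟨ cong₂ _-_ (inner--ʳ x x y) (inner--ʳ y x y) ⟩
    (⟪ x , x ⟫ - ⟪ x , y ⟫) - (⟪ y , x ⟫ - ⟪ y , y ⟫)    ≡⟨ cong (λ t → (⟪ x , x ⟫ - ⟪ x , y ⟫) - (t - ⟪ y , y ⟫)) (inner-sym y x) ⟩
    (⟪ x , x ⟫ - ⟪ x , y ⟫) - (⟪ x , y ⟫ - ⟪ y , y ⟫)    ≡⟨ solve 3 (λ p q r → (p :- q) :- (q :- r) := (p :+ r) :- con (ι (+ 2)) :* q) refl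
                                                              ⟪ x , x ⟫ ⟪ x , y ⟫ ⟪ y , y ⟫ ⟩
    (⟪ x , x ⟫ + ⟪ y , y ⟫) - ι (+ 2) * ⟪ x , y ⟫        ∎
    where open ≡-Reasoning

  inner-comboʳ : ∀ {m} x (c : Fin m → ℚ) (f : Fin m → Vec n) → ⟪ x , combo c f ⟫ ≡ Σ[ m ] (λ j → c j * ⟪ x , f j ⟫)
  inner-comboʳ {zero}  x c f = inner-zeroʳ x
  inner-comboʳ {suc m} x c f = trans (inner-+ʳ x (c zero · f zero) (combo (λ j → c (suc j)) (λ j → f (suc j))))
    (cong₂ _+_ (inner-·ʳ (c zero) x (f zero)) (inner-comboʳ x (λ j → c (suc j)) (λ j → f (suc j))))

  inner-comboˡ : ∀ {m} (c : Fin m → ℚ) (f : Fin m → Vec n) y → ⟪ combo c f , y ⟫ ≡ Σ[ m ] (λ j → c j * ⟪ f j , y ⟫)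
  inner-comboˡ {m} c f y = trans (inner-sym (combo c f) y)
    (trans (inner-comboʳ y c f) (Σ-cong m (λ j → cong (c j *_) (inner-sym y (f j)))))

  orthogonal-combo : ∀ {m} (f : Fin m → Vec n) r → (∀ j → ⟪ f j , f j ⟫ ≡ r) →
    (∀ i j → i ≢ j → ⟪ f i , f j ⟫ ≡ 0ℚ) →
    ∀ c d → ⟪ combo c f , combo d f ⟫ ≡ r * Σ[ m ] (λ j → c j * d j)
  orthogonal-combo {m} f r f-norm f-orth c d = begin
    ⟪ combo c f , combo d f ⟫                 ≡⟨ inner-comboˡ c f (combo d f) ⟩
    Σ[ m ] (λ j → c j * ⟪ f j , combo d f ⟫)  ≡⟨ Σ-cong m (λ j → cong (c j *_) (coordinate j)) ⟩
    Σ[ m ] (λ j → c j * (d j * r))            ≡⟨ Σ-cong m (λ j → solve 3 (λ a b r → a :* (b :* r) := r :* (a :* b)) refl (c j) (d j) r) ⟩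
    Σ[ m ] (λ j → r * (c j * d j))            ≡⟨ Σ-* m r (λ j → c j * d j) ⟩
    r * Σ[ m ] (λ j → c j * d j)              ∎
    where
    open ≡-Reasoning
    -- only the j-th term of Σₗ dₗ (fⱼ, fₗ) survives
    coordinate : ∀ j → ⟪ f j , combo d f ⟫ ≡ d j * r
    coordinate j = trans (inner-comboʳ (f j) d f)
      (trans (Σ-δ m j (λ l → d l * ⟪ f j , f l ⟫) (λ l l≢j → trans (cong (d l *_) (f-orth j l (λ e → l≢j (sym e)))) (*-zeroʳ (d l))))
             (cong (d j *_) (f-norm j)))

InL-- : ∀ {n} {x y : Vec n} → InL x → InL y → InL (x -ᵥ y)
InL-- x∈L y∈L k = int-- (x∈L k) (y∈L k)

InL-· : ∀ {n c} {x : Vec n} → IsInt c → InL x → InL (c · x)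
InL-· c-int x∈L k = int-* c-int (x∈L k)

InL-combo : ∀ {m n} {c : Fin m → ℚ} {f : Fin m → Vec n} → (∀ j → IsInt (c j)) → (∀ j → InL (f j)) → InL (combo c f)
InL-combo {m} {c = c} {f} c-int f∈L k = Σ-int m (λ j → c j * f j k) (λ j → int-* (c-int j) (f∈L j k))

norm-nonneg : ∀ {n} (G : Gram n) → IsLatticeGram G → ∀ y → InL y → 0ℚ ≤ norm G y
norm-nonneg G (G-sym , G-pos) y y∈L with all? (λ k → y k ≟ 0ℚ)
... | yes y≡0 = ≤-reflexive (sym (trans (inner-congʳ y y≡0) (inner-zeroʳ y)))
  where open Form G G-sym
... | no  y≢0 = <⇒≤ (G-pos y y∈L y≢0)

≤-from-nonneg-multiple : ∀ k .{{_ : Positive k}} {p q} → 0ℚ ≤ k * (q - p) → p ≤ q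
≤-from-nonneg-multiple k {p} {q} 0≤k[q-p] = begin
  p            ≡⟨ sym (+-identityʳ p) ⟩
  p + 0ℚ       ≤⟨ +-monoʳ-≤ p (*-cancelˡ-≤-pos k (subst (_≤ k * (q - p)) (sym (*-zeroʳ k)) 0≤k[q-p])) ⟩
  p + (q - p)  ≡⟨ solve 2 (λ p q → p :+ (q :- p) := q) refl p q ⟩
  q            ∎
  where
  open ≤-Reasoning
  open +-*-Solver

-- The witness is y = 3x − Σⱼ (x, fⱼ) fⱼ,
-- a lattice vector of norm 3 (3 (x, x) − Σⱼ (x, fⱼ)²).
bessel₃ : ∀ {m n} (G : Gram n) → IsLatticeGram G → IsIntegral G →
  (f : Fin m → Vec n) → (∀ j → InL (f j)) → (∀ j → inner G (f j) (f j) ≡ ι (+ 3)) →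
  (∀ i j → i ≢ j → inner G (f i) (f j) ≡ 0ℚ) →
  ∀ x → InL x → Σ[ m ] (λ j → inner G x (f j) * inner G x (f j)) ≤ ι (+ 3) * norm G x
bessel₃ {m} G G-lat@(G-sym , _) G-int f f∈L f-norm f-orth x x∈L =
  ≤-from-nonneg-multiple (ι (+ 3)) (subst (0ℚ ≤_) norm-y (norm-nonneg G G-lat y y∈L))
  where
  open Form G G-sym
  open +-*-Solver

  c : Fin m → ℚ
  c j = ⟪ x , f j ⟫

  Q : ℚ
  Q = Σ[ m ] (λ j → c j * c j)

  y : Vec _
  y = (ι (+ 3) · x) -ᵥ combo c f

  y∈L : InL y
  y∈L = InL-- (InL-· (+ 3 , refl) x∈L) (InL-combo (λ j → G-int x x∈L (f j) (f∈L j)) f∈L)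

  norm-y : ⟪ y , y ⟫ ≡ ι (+ 3) * (ι (+ 3) * ⟪ x , x ⟫ - Q)
  norm-y = begin
    ⟪ y , y ⟫
      ≡⟨ norm-- (ι (+ 3) · x) (combo c f) ⟩
    (⟪ ι (+ 3) · x , ι (+ 3) · x ⟫ + ⟪ combo c f , combo c f ⟫) - ι (+ 2) * ⟪ ι (+ 3) · x , combo c f ⟫
      ≡⟨ cong₂ (λ p q → (p + ⟪ combo c f , combo c f ⟫) - ι (+ 2) * q)
           (trans (inner-·ˡ (ι (+ 3)) x (ι (+ 3) · x)) (cong (ι (+ 3) *_) (inner-·ʳ (ι (+ 3)) x x)))
           (trans (inner-·ˡ (ι (+ 3)) x (combo c f)) (cong (ι (+ 3) *_) (inner-comboʳ x c f))) ⟩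
    (ι (+ 3) * (ι (+ 3) * ⟪ x , x ⟫) + ⟪ combo c f , combo c f ⟫) - ι (+ 2) * (ι (+ 3) * Q)
      ≡⟨ cong (λ s → (ι (+ 3) * (ι (+ 3) * ⟪ x , x ⟫) + s) - ι (+ 2) * (ι (+ 3) * Q))
           (orthogonal-combo f (ι (+ 3)) f-norm f-orth c c) ⟩
    (ι (+ 3) * (ι (+ 3) * ⟪ x , x ⟫) + ι (+ 3) * Q) - ι (+ 2) * (ι (+ 3) * Q)
      ≡⟨ solve 2 (λ N Q → (con (ι (+ 3)) :* (con (ι (+ 3)) :* N) :+ con (ι (+ 3)) :* Q) :- con (ι (+ 2)) :* (con (ι (+ 3)) :* Q)
                          := con (ι (+ 3)) :* (con (ι (+ 3)) :* N :- Q)) refl ⟪ x , x ⟫ Q ⟩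
    ι (+ 3) * (ι (+ 3) * ⟪ x , x ⟫ - Q)
      ∎
    where open ≡-Reasoning

IsCharacteristic : ∀ {n} → Gram n → Vec n → Set
IsCharacteristic G x = ∀ y → InL y →
  (IsEvenInt (norm G y) → IsEvenInt (inner G x y)) × (IsOddInt (norm G y) → IsOddInt (inner G x y))

-- A characteristic vector pairs integrally with L, hence lies in L* = L.
characteristic∈L : ∀ {n} {G : Gram n} x → IsUnimodular G → IsCharacteristic G x → InL x
characteristic∈L x (G-int , L*⊆L) x-char = L*⊆L x (λ y y∈L →
  [ (λ y-even → even⇒int (proj₁ (x-char y y∈L) y-even)) , (λ y-odd → odd⇒int (proj₂ (x-char y y∈L) y-odd)) ]
    (parity (G-int y y∈L y y∈L)))

-- Two lattice vectors of odd norm differ by a vector of L₀, since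
-- (y − u, y − u) = (y, y) + (u, u) − 2 (y, u).
odd-difference∈L₀ : ∀ {n} (G : Gram n) (G-sym : ∀ i j → G i j ≡ G j i) → IsIntegral G →
  ∀ {y u} → InL y → InL u → IsOddInt (norm G y) → IsOddInt (norm G u) → InL0 G (y -ᵥ u)
odd-difference∈L₀ G G-sym G-int {y} {u} y∈L u∈L y-odd u-odd =
  InL-- y∈L u∈L ,
  subst IsEvenInt (sym (norm-- y u)) (even-even (odd+odd y-odd u-odd) (twice-even (G-int y y∈L u u∈L)))
  where open Form G G-sym

-- If a ∈ L₀* and 2 (a, u) is odd for some u ∈ L of odd norm, then 2a is
-- characteristic: for y ∈ L₀, 2 (a, y) is even; for y of odd norm,
-- 2 (a, y) = 2 (a, y − u) + 2 (a, u) with y − u ∈ L₀.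
twice-characteristic : ∀ {n} (G : Gram n) (G-sym : ∀ i j → G i j ≡ G j i) → IsIntegral G →
  ∀ a u → InL0Dual G a → InL u → IsOddInt (norm G u) → IsOddInt (ι (+ 2) * inner G a u) →
  IsCharacteristic G (ι (+ 2) · a)
twice-characteristic G G-sym G-int a u a∈L₀* u∈L u-odd 2⟨a,u⟩-odd y y∈L = even-case , odd-case
  where
  open Form G G-sym
  open +-*-Solver

  even-case : IsEvenInt ⟪ y , y ⟫ → IsEvenInt ⟪ ι (+ 2) · a , y ⟫
  even-case y-even =
    subst IsEvenInt (sym (inner-·ˡ (ι (+ 2)) a y)) (twice-even (a∈L₀* y (y∈L , y-even)))

  split : ⟪ ι (+ 2) · a , y ⟫ ≡ ι (+ 2) * ⟪ a , y -ᵥ u ⟫ + ι (+ 2) * ⟪ a , u ⟫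
  split = begin
    ⟪ ι (+ 2) · a , y ⟫                                       ≡⟨ inner-·ˡ (ι (+ 2)) a y ⟩
    ι (+ 2) * ⟪ a , y ⟫                                       ≡⟨ solve 2 (λ p q → con (ι (+ 2)) :* p := con (ι (+ 2)) :* (p :- q) :+ con (ι (+ 2)) :* q) refl ⟪ a , y ⟫ ⟪ a , u ⟫ ⟩
    ι (+ 2) * (⟪ a , y ⟫ - ⟪ a , u ⟫) + ι (+ 2) * ⟪ a , u ⟫   ≡⟨ cong (λ s → ι (+ 2) * s + ι (+ 2) * ⟪ a , u ⟫) (sym (inner--ʳ a y u)) ⟩
    ι (+ 2) * ⟪ a , y -ᵥ u ⟫ + ι (+ 2) * ⟪ a , u ⟫           ∎
    where open ≡-Reasoning

  odd-case : IsOddInt ⟪ y , y ⟫ → IsOddInt ⟪ ι (+ 2) · a , y ⟫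
  odd-case y-odd = subst IsOddInt (sym split)
    (even+odd (twice-even (a∈L₀* (y -ᵥ u) (odd-difference∈L₀ G G-sym G-int y∈L u∈L y-odd u-odd))) 2⟨a,u⟩-odd)

lemma2p3 : (G : Gram 24) → IsLatticeGram G → IsUnimodular G → IsOdd G →
    (v : Vec 24) → InL2 G v → norm G v ≡ + 3 / 1 →
    (Σ (Vec 24) λ a → Σ (Vec 24) λ b →
        InShadow G a × InShadow G b × ¬ SameCoset G a b
      × norm G a ≡ + 2 / 1 × norm G b ≡ + 2 / 1 × inner G a b ≡ ½
      × (∀ k → v k ≡ (a -ᵥ b) k)) →
    ¬ InSome3Frame G v
lemma2p3 G G-lat@(G-sym , _) G-uni@(G-int , _) _ v _ _
         (a , b , (a∈L₀* , _) , _ , _ , ⟨a,a⟩≡2 , _ , ⟨a,b⟩≡½ , v≡a-b)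
         (f , (f∈L , f-norm , f-orth) , i , fᵢ≡v) =
  <-irrefl refl (<-≤-trans Q>24 Q≤24)
  where
  open Form G G-sym

  -- 2 (a, fᵢ) = 2 ((a, a) − (a, b)) = 3
  2⟨a,fᵢ⟩≡3 : ι (+ 2) * ⟪ a , f i ⟫ ≡ ι (+ 3)
  2⟨a,fᵢ⟩≡3 = cong (ι (+ 2) *_)
    (trans (inner-congʳ a (λ k → trans (fᵢ≡v k) (v≡a-b k)))
      (trans (inner--ʳ a a b) (cong₂ _-_ ⟨a,a⟩≡2 ⟨a,b⟩≡½)))

  x : Vec 24
  x = ι (+ 2) · a

  x-char : IsCharacteristic G x
  x-char = twice-characteristic G G-sym G-int a (f i) a∈L₀* (f∈L i) (+ 1 , f-norm i) (+ 1 , 2⟨a,fᵢ⟩≡3)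

  c : Fin 24 → ℚ
  c j = inner G x (f j)

  -- x is characteristic and (fⱼ, fⱼ) = 3 is odd, so each (x, fⱼ) is odd
  c-odd : ∀ j → IsOddInt (c j)
  c-odd j = proj₂ (x-char (f j) (f∈L j)) (+ 1 , f-norm j)

  cᵢ≡3 : c i ≡ ι (+ 3)
  cᵢ≡3 = trans (inner-·ˡ (ι (+ 2)) a (f i)) 2⟨a,fᵢ⟩≡3

  -- all 24 odd squares are ≥ 1 and cᵢ² = 9
  Q>24 : ι (+ 24) < Σ[ 24 ] (λ j → c j * c j)
  Q>24 = Σ-exceeds-count 24 (λ j → c j * c j) i (λ j → odd-square≥1 (c-odd j))
    (subst (λ t → ι (+ 1) < t * t) (sym cᵢ≡3) (*<* (ℤ.+<+ (s≤s (s≤s z≤n)))))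

  ⟨x,x⟩≡8 : norm G x ≡ ι (+ 8)
  ⟨x,x⟩≡8 = trans (inner-·ˡ (ι (+ 2)) a x)
    (cong (ι (+ 2) *_) (trans (inner-·ʳ (ι (+ 2)) a a) (cong (ι (+ 2) *_) ⟨a,a⟩≡2)))

  Q≤24 : Σ[ 24 ] (λ j → c j * c j) ≤ ι (+ 24)
  Q≤24 = begin
    Σ[ 24 ] (λ j → c j * c j)  ≤⟨ bessel₃ G G-lat G-int f f∈L f-norm f-orth x (characteristic∈L {G = G} x G-uni x-char) ⟩
    ι (+ 3) * norm G x         ≡⟨ cong (ι (+ 3) *_) ⟨x,x⟩≡8 ⟩
    ι (+ 24)                   ∎
    where open ≤-Reasoning
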